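{- For all $r \in \mathbb{C}$, \[ e^{y\frac{d}{dx}}\big(\ell_{ -2}(x)^{r}\big)=\ell_{ -2}(x)^{r}\sum_{m \geq 0}\frac{y^{m}}{m!}\sum_{j=0}^{m}(r\ell_{ -1}(x))^{j}\sum_{0 \leq t_{1} \leq t_{2} \leq \cdots \leq t_{m-j}\leq j}t_{1}\cdots t_{m-j}, \] where the inner sum is over integers $t_1,\dots,t_{m-j}$, an empty product equals $1$, and $r^0=1$.
   Context: Let $\ell_{n}(x)$, $n \in \mathbb{Z}$, be commuting formal variables and let $\mathbb{C}\{[\ell]\}$ be the commutative algebra with basis all monomials $\prod_{i}\ell_{i}(x)^{r_{i}}$, $r_i\in\mathbb{C}$, almost all zero, multiplication adding exponents. Let $\frac{d}{dx}$ be the unique derivation with $\frac{d}{dx}\ell_{0}(x)^{r}=r\ell_{0}(x)^{r-1}$ and, for $n>0$, $\frac{d}{dx}\ell_{n}(x)^{r}=r\ell_{n}(x)^{r-1}\prod_{i=0}^{n-1}\ell_{i}(x)^{ -1}$, $\frac{d}{dx}\ell_{ -n}(x)^{r}=r\ell_{ -n}(x)^{r-1}\prod_{i=1}^{n}\ell_{ -i}(x)$ (so $\frac{d}{dx}\ell_{ -1}(x)^r=r\ell_{ -1}(x)^r$ and $\frac{d}{dx}\ell_{ -2}(x)^r=r\ell_{ -1}(x)\ell_{ -2}(x)^r$). $y$ is a formal variable and $e^{y\frac{d}{dx}}=\sum_{k\ge0}\frac{y^k}{k!}(\frac{d}{dx})^k$. -}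

module Defs where

open import Level using (_⊔_)
open import Data.Nat as ℕ using (ℕ; zero; suc; _∸_)
open import Data.Integer as ℤ using (ℤ; +_; -[1+_])
open import Data.Product using (_×_; _,_)
open import Data.List using (List; []; _∷_; _++_; map; concatMap; upTo; foldr)
open import Relation.Nullary using (yes; no)
open import Algebra.Bundles using (CommutativeRing)

range : ℕ → ℕ → List ℕ
range lo hi = map (lo ℕ.+_) (upTo (suc hi ∸ lo))

-- all non-decreasing sequences lo ≤ t₁ ≤ t₂ ≤ ⋯ ≤ t_k ≤ j  (as lists of length k)
ndSeqs : ℕ → ℕ → ℕ → List (List ℕ)
ndSeqs zero    lo j = [] ∷ []
ndSeqs (suc k) lo j = concatMap (λ t → map (t ∷_) (ndSeqs k t j)) (range lo j)

prodℕ : List ℕ → ℕ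
prodℕ = foldr ℕ._*_ 1

sumℕ : List ℕ → ℕ
sumℕ = foldr ℕ._+_ 0

S : ℕ → ℕ → ℕ
S j k = sumℕ (map prodℕ (ndSeqs k 0 j))

module LAlg {c ℓ} (R : CommutativeRing c ℓ) where
  open CommutativeRing R public

  fromℕ : ℕ → Carrier
  fromℕ zero    = 0#
  fromℕ (suc n) = 1# + fromℕ n

  pow : Carrier → ℕ → Carrier
  pow x zero    = 1#
  pow x (suc n) = x * pow x n

  -- 1 / m!, given inv n = 1/(n+1)
  invFact : (ℕ → Carrier) → ℕ → Carrier
  invFact inv zero    = 1#
  invFact inv (suc m) = inv m * invFact inv m

  -- A monomial ∏ ℓ_i(x)^{r_i} is written as a finite list of factors (i , r);
  -- repeated indices multiply (exponents add).
  Mono : Set c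
  Mono = List (ℤ × Carrier)

  expo : Mono → ℤ → Carrier
  expo []            i = 0#
  expo ((j , r) ∷ m) i with j ℤ.≟ i
  ... | yes _ = r + expo m i
  ... | no  _ = expo m i

  _~_ : Mono → Mono → Set ℓ
  m ~ m' = ∀ i → expo m i ≈ expo m' i

  Poly : Set c
  Poly = List (Carrier × Mono)

  -- equality of elements: the congruence presenting the free module on monomials
  infix 4 _≋_
  data _≋_ : Poly → Poly → Set (c ⊔ ℓ) where
    ≋-refl  : ∀ {a} → a ≋ a
    ≋-sym   : ∀ {a b} → a ≋ b → b ≋ a
    ≋-trans : ∀ {a b d} → a ≋ b → b ≋ d → a ≋ d
    ≋-cons  : ∀ {t a b} → a ≋ b → (t ∷ a) ≋ (t ∷ b)
    ≋-swap  : ∀ {t u a} → (t ∷ u ∷ a) ≋ (u ∷ t ∷ a)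
    ≋-term  : ∀ {x y m m' a} → x ≈ y → m ~ m' → ((x , m) ∷ a) ≋ ((y , m') ∷ a)
    ≋-merge : ∀ {x y m a} → ((x , m) ∷ (y , m) ∷ a) ≋ ((x + y , m) ∷ a)
    ≋-zero  : ∀ {m a} → ((0# , m) ∷ a) ≋ a

  _⊕_ : Poly → Poly → Poly
  _⊕_ = _++_

  scale : Carrier → Poly → Poly
  scale k = map (λ { (x , m) → (k * x , m) })

  _⊗_ : Poly → Poly → Poly
  p ⊗ q = concatMap (λ { (x , m) → map (λ { (y , n) → (x * y , m ++ n) }) q }) p

  ΣP : List Poly → Poly
  ΣP = foldr _⊕_ []

  ℓ^ : ℤ → Carrier → Poly
  ℓ^ i r = (1# , (i , r) ∷ []) ∷ []

  -- the extra factor in d/dx ℓ_i^r = r ℓ_i^{r-1} · factor i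
  --   factor 0 = 1, factor n = ∏_{k=0}^{n-1} ℓ_k^{-1}, factor (-n) = ∏_{k=1}^{n} ℓ_{-k}
  factor : ℤ → Mono
  factor (+ zero)  = []
  factor (+ suc n) = map (λ k → (+ k , - 1#)) (upTo (suc n))
  factor -[1+ n ]  = map (λ k → (-[1+ k ] , 1#)) (upTo (suc n))

  dTerm : Carrier × Mono → Poly
  dTerm (x , m) = map (λ { (i , r) → (x * r , m ++ ((i , - 1#) ∷ factor i)) }) m

  D : Poly → Poly
  D = concatMap dTerm

  Dⁿ : ℕ → Poly → Poly
  Dⁿ zero    p = p
  Dⁿ (suc n) p = D (Dⁿ n p)

  -- formal power series in y with coefficients in ℂ{[ℓ]}: m ↦ coefficient of y^m
  Series : Set c
  Series = ℕ → Poly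

  _≋ₛ_ : Series → Series → Set (c ⊔ ℓ)
  f ≋ₛ g = ∀ m → f m ≋ g m

  expYD : (ℕ → Carrier) → Poly → Series
  expYD inv a m = scale (invFact inv m) (Dⁿ m a)

-- By the Leibniz rule, d/dx (ℓ₋₂^r ℓ₋₁^j) = r ℓ₋₂^r ℓ₋₁^(j+1) + j ℓ₋₂^r ℓ₋₁^j, so (d/dx)^m ℓ₋₂^r
-- is a combination Σ_j c_(m,j) ℓ₋₂^r ℓ₋₁^j with c_(m+1,j) = r c_(m,j-1) + j c_(m,j). The claimed
-- coefficients c_(m,j) = r^j S(j, m-j) obey this recursion because
-- S(j, k+1) = S(j-1, k+1) + j S(j, k), which follows by sorting the non-decreasing sequences
-- according to whether their last entry equals j. As elements of the algebra are lists of terms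
-- taken modulo ≋, one must also check that d/dx respects ≋; the substantial case is that the
-- derivative of a monomial depends only on its exponent vector, not on how it is written as a list.

module Submission where

open import Level using (Level; _⊔_)
open import Function using (_∘_)
open import Data.Nat as ℕ using (ℕ; zero; suc; _∸_; _≤_; _<_; s≤s)
import Data.Nat.Properties as ℕₚ
open import Data.Nat.ListAction.Properties using (sum-++)
open import Data.Nat.Solver using (module +-*-Solver)
open import Data.Integer as ℤ using (ℤ; -[1+_])
open import Data.Product using (_×_; _,_; proj₁; proj₂)
open import Data.List using (List; []; _∷_; _++_; map; filter; upTo; applyUpTo; length)
import Data.List.Properties as Listₚ
open import Data.List.Relation.Unary.All as All using (All; []; _∷_)
open import Data.List.Relation.Unary.All.Properties using (all-filter)
open import Data.List.Relation.Binary.Permutation.Propositional as Perm using (_↭_)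
open import Data.List.Relation.Binary.Permutation.Propositional.Properties using (shift; shifts)
open import Data.Empty using (⊥-elim)
open import Relation.Nullary using (yes; no; ¬?)
open import Relation.Binary.Bundles using (Setoid)
import Relation.Binary.Reasoning.Setoid as SetoidReasoning
open import Relation.Binary.PropositionalEquality as ≡ using (_≡_; _≢_)
open import Algebra.Bundles using (CommutativeRing)
import Algebra.Properties.Semiring.Mult as SemiringMult

open import Defs

applyFrom : ∀ {a} {A : Set a} → (ℕ → A) → ℕ → ℕ → List A
applyFrom f k zero    = []
applyFrom f k (suc n) = f k ∷ applyFrom f (suc k) n

applyFrom-suc : ∀ {a} {A : Set a} (f : ℕ → A) k n → applyFrom f (suc k) n ≡ applyFrom (f ∘ suc) k n
applyFrom-suc f k zero    = ≡.refl
applyFrom-suc f k (suc n) = ≡.cong (f (suc k) ∷_) (applyFrom-suc f (suc k) n)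

applyFrom-zero : ∀ {a} {A : Set a} (f : ℕ → A) n → applyFrom f 0 n ≡ applyUpTo f n
applyFrom-zero f zero    = ≡.refl
applyFrom-zero f (suc n) =
  ≡.cong (f 0 ∷_) (≡.trans (applyFrom-suc f 0 n) (applyFrom-zero (f ∘ suc) n))

-- ndSum lo j k = Σ_{lo ≤ t₁ ≤ ⋯ ≤ t_k ≤ j} t₁ ⋯ t_k is the complete homogeneous symmetric
-- polynomial h_k(lo, …, j), and S j k = ndSum 0 j k.
ndSum : ℕ → ℕ → ℕ → ℕ
ndSum lo j k = sumℕ (map prodℕ (ndSeqs k lo j))

range-head : ∀ {lo hi} → lo ≤ hi → range lo hi ≡ lo ∷ range (suc lo) hi
range-head {lo} {hi} lo≤hi rewrite ℕₚ.+-∸-assoc 1 lo≤hi =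
  ≡.cong₂ _∷_ (ℕₚ.+-identityʳ lo) (begin
    map (lo ℕ.+_) (applyUpTo suc n)        ≡⟨ ≡.cong (map (lo ℕ.+_)) (Listₚ.map-upTo suc n) ⟨
    map (lo ℕ.+_) (map suc (upTo n))       ≡⟨ Listₚ.map-∘ (upTo n) ⟨
    map ((lo ℕ.+_) ∘ suc) (upTo n)         ≡⟨ Listₚ.map-cong (ℕₚ.+-suc lo) (upTo n) ⟩
    map (suc lo ℕ.+_) (upTo n)             ∎)
  where
  open ≡.≡-Reasoning
  n = hi ∸ lo

range-empty : ∀ {lo hi} → hi < lo → range lo hi ≡ []
range-empty hi<lo rewrite ℕₚ.m≤n⇒m∸n≡0 hi<lo = ≡.refl

sum-prod-cons : ∀ t (xss : List (List ℕ)) →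
  sumℕ (map prodℕ (map (t ∷_) xss)) ≡ t ℕ.* sumℕ (map prodℕ xss)
sum-prod-cons t []         = ≡.sym (ℕₚ.*-zeroʳ t)
sum-prod-cons t (xs ∷ xss) rewrite sum-prod-cons t xss =
  ≡.sym (ℕₚ.*-distribˡ-+ t (prodℕ xs) (sumℕ (map prodℕ xss)))

ndSum-head : ∀ {lo j} k → lo ≤ j → ndSum lo j (suc k) ≡ lo ℕ.* ndSum lo j k ℕ.+ ndSum (suc lo) j (suc k)
ndSum-head {lo} {j} k lo≤j
  rewrite range-head lo≤j
        | Listₚ.map-++ prodℕ (map (lo ∷_) (ndSeqs k lo j)) (ndSeqs (suc k) (suc lo) j)
        | sum-++ (map prodℕ (map (lo ∷_) (ndSeqs k lo j))) (map prodℕ (ndSeqs (suc k) (suc lo) j))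
        | sum-prod-cons lo (ndSeqs k lo j) = ≡.refl

ndSum-empty : ∀ {lo j} k → j < lo → ndSum lo j (suc k) ≡ 0
ndSum-empty k j<lo rewrite range-empty j<lo = ≡.refl

-- Splitting off the sequences with t_k = j + 1.
LastSplit : ℕ → ℕ → ℕ → Set
LastSplit lo j k = ndSum lo (suc j) (suc k) ≡ ndSum lo j (suc k) ℕ.+ suc j ℕ.* ndSum lo (suc j) k

ndSum-last-step : ∀ {lo j} → lo ≤ j → (∀ k → LastSplit (suc lo) j k) → ∀ k → LastSplit lo j k
ndSum-last-step {lo} {j} lo≤j split zero
  rewrite ndSum-head 0 (ℕₚ.m≤n⇒m≤1+n lo≤j) | split 0 | ndSum-head 0 lo≤j =
  ≡.sym (ℕₚ.+-assoc (lo ℕ.* 1) (ndSum (suc lo) j 1) (suc j ℕ.* 1))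
ndSum-last-step {lo} {j} lo≤j split (suc k) = begin
  ndSum lo (suc j) (suc (suc k))
    ≡⟨ ndSum-head (suc k) (ℕₚ.m≤n⇒m≤1+n lo≤j) ⟩
  lo * ndSum lo (suc j) (suc k) + ndSum (suc lo) (suc j) (suc (suc k))
    ≡⟨ ≡.cong₂ (λ u v → lo * u + v) (ndSum-last-step lo≤j split k) (split (suc k)) ⟩
  lo * (ndSum lo j (suc k) + suc j * ndSum lo (suc j) k)
    + (ndSum (suc lo) j (suc (suc k)) + suc j * ndSum (suc lo) (suc j) (suc k))
    ≡⟨ solve 6 (λ l b s c x y → l :* (b :+ s :* c) :+ (x :+ s :* y) := (l :* b :+ x) :+ s :* (l :* c :+ y))
             ≡.refl lo (ndSum lo j (suc k)) (suc j) (ndSum lo (suc j) k)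
             (ndSum (suc lo) j (suc (suc k))) (ndSum (suc lo) (suc j) (suc k)) ⟩
  (lo * ndSum lo j (suc k) + ndSum (suc lo) j (suc (suc k)))
    + suc j * (lo * ndSum lo (suc j) k + ndSum (suc lo) (suc j) (suc k))
    ≡⟨ ≡.cong₂ (λ u v → u + suc j * v) (ndSum-head (suc k) lo≤j) (ndSum-head k (ℕₚ.m≤n⇒m≤1+n lo≤j)) ⟨
  ndSum lo j (suc (suc k)) + suc j * ndSum lo (suc j) (suc k) ∎
  where
  open ≡.≡-Reasoning
  open import Data.Nat.Base using (_+_; _*_)
  open +-*-Solver

ndSum-last : ∀ gap lo {j} → gap ℕ.+ lo ≡ suc j → ∀ k → LastSplit lo j k
ndSum-last zero .(suc j) {j} ≡.refl k
  rewrite ndSum-head k (ℕₚ.≤-refl {suc j})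
        | ndSum-empty {suc (suc j)} k ℕₚ.≤-refl
        | ndSum-empty {suc j} k ℕₚ.≤-refl = ℕₚ.+-identityʳ _
ndSum-last (suc gap) lo {j} eq =
  ndSum-last-step (≡.subst (lo ≤_) (ℕₚ.suc-injective eq) (ℕₚ.m≤n+m lo gap))
                  (ndSum-last gap (suc lo) (≡.trans (ℕₚ.+-suc gap lo) eq))

S-zero : ∀ k → S 0 (suc k) ≡ 0
S-zero k = ≡.trans (ndSum-head k ℕ.z≤n) (ndSum-empty {1} k (s≤s ℕ.z≤n))

S-last : ∀ j k → S (suc j) (suc k) ≡ S j (suc k) ℕ.+ suc j ℕ.* S (suc j) k
S-last j k = ndSum-last (suc j) 0 (ℕₚ.+-identityʳ (suc j)) k

module _ {c ℓ} (R : CommutativeRing c ℓ) where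
  open LAlg R
  open SemiringMult semiring using (×-homo-+; ×1-homo-*) renaming (_×_ to _·_)

  expo-++ : ∀ m n i → expo (m ++ n) i ≈ expo m i + expo n i
  expo-++ []            n i = sym (+-identityˡ _)
  expo-++ ((j , r) ∷ m) n i with j ℤ.≟ i
  ... | yes _ = trans (+-congˡ (expo-++ m n i)) (sym (+-assoc _ _ _))
  ... | no  _ = expo-++ m n i

  ~-++ʳ : ∀ {m m'} n → m ~ m' → (m ++ n) ~ (m' ++ n)
  ~-++ʳ {m} {m'} n m~m' i = trans (expo-++ m n i) (trans (+-congʳ (m~m' i)) (sym (expo-++ m' n i)))

  expo-∉ : ∀ {i m} → All (λ p → i ≢ proj₁ p) m → expo m i ≈ 0#
  expo-∉ [] = refl
  expo-∉ {i} {(j , r) ∷ m} (i≢j ∷ i∉m) with j ℤ.≟ i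
  ... | yes j≡i = ⊥-elim (i≢j (≡.sym j≡i))
  ... | no  _   = expo-∉ i∉m

  dropIndex : ℤ → Mono → Mono
  dropIndex i = filter (λ p → ¬? (proj₁ p ℤ.≟ i))

  dropIndex-head : ∀ i r m → dropIndex i ((i , r) ∷ m) ≡ dropIndex i m
  dropIndex-head i r m with i ℤ.≟ i
  ... | yes _   = ≡.refl
  ... | no  i≢i = ⊥-elim (i≢i ≡.refl)

  length-dropIndex-head : ∀ i r m → length (dropIndex i ((i , r) ∷ m)) ≤ length m
  length-dropIndex-head i r m rewrite dropIndex-head i r m = Listₚ.length-filter _ m

  expo-dropIndex : ∀ {i k} m → i ≢ k → expo (dropIndex i m) k ≈ expo m k
  expo-dropIndex [] i≢k = refl
  expo-dropIndex {i} {k} ((j , r) ∷ m) i≢k with j ℤ.≟ i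
  ... | yes ≡.refl with i ℤ.≟ k
  ...   | yes i≡k = ⊥-elim (i≢k i≡k)
  ...   | no  _   = expo-dropIndex m i≢k
  expo-dropIndex {i} {k} ((j , r) ∷ m) i≢k | no _ with j ℤ.≟ k
  ...   | yes _ = +-congˡ (expo-dropIndex m i≢k)
  ...   | no  _ = expo-dropIndex m i≢k

  dropIndex-cong : ∀ i {m m'} → m ~ m' → dropIndex i m ~ dropIndex i m'
  dropIndex-cong i {m} {m'} m~m' k with i ℤ.≟ k
  ... | yes ≡.refl = trans (expo-∉ (All.map ≡.≢-sym (all-filter _ m)))
                           (sym (expo-∉ (All.map ≡.≢-sym (all-filter _ m'))))
  ... | no  i≢k    = trans (expo-dropIndex m i≢k) (trans (m~m' k) (sym (expo-dropIndex m' i≢k)))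

  ≋-setoid : Setoid c (c ⊔ ℓ)
  ≋-setoid = record
    { Carrier       = Poly
    ; _≈_           = _≋_
    ; isEquivalence = record { refl = ≋-refl ; sym = ≋-sym ; trans = ≋-trans }
    }

  ↭⇒≋ : ∀ {a b} → a ↭ b → a ≋ b
  ↭⇒≋ Perm.refl          = ≋-refl
  ↭⇒≋ (Perm.prep _ p)    = ≋-cons (↭⇒≋ p)
  ↭⇒≋ (Perm.swap _ _ p)  = ≋-trans ≋-swap (≋-cons (≋-cons (↭⇒≋ p)))
  ↭⇒≋ (Perm.trans p q)   = ≋-trans (↭⇒≋ p) (↭⇒≋ q)

  ≋-++⁺ˡ : ∀ a {b b'} → b ≋ b' → (a ++ b) ≋ (a ++ b')
  ≋-++⁺ˡ []      b≋b' = b≋b'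
  ≋-++⁺ˡ (t ∷ a) b≋b' = ≋-cons (≋-++⁺ˡ a b≋b')

  ≋-++⁺ʳ : ∀ {a a'} b → a ≋ a' → (a ++ b) ≋ (a' ++ b)
  ≋-++⁺ʳ b ≋-refl          = ≋-refl
  ≋-++⁺ʳ b (≋-sym p)       = ≋-sym (≋-++⁺ʳ b p)
  ≋-++⁺ʳ b (≋-trans p q)   = ≋-trans (≋-++⁺ʳ b p) (≋-++⁺ʳ b q)
  ≋-++⁺ʳ b (≋-cons p)      = ≋-cons (≋-++⁺ʳ b p)
  ≋-++⁺ʳ b ≋-swap          = ≋-swap
  ≋-++⁺ʳ b (≋-term x≈y m~m') = ≋-term x≈y m~m'
  ≋-++⁺ʳ b ≋-merge         = ≋-merge
  ≋-++⁺ʳ b ≋-zero          = ≋-zero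

  ≋-coeff : ∀ {x y m a} → x ≈ y → ((x , m) ∷ a) ≋ ((y , m) ∷ a)
  ≋-coeff {m = m} x≈y = ≋-term {m = m} {m' = m} x≈y (λ _ → refl)

  scale-cong : ∀ k {a b} → a ≋ b → scale k a ≋ scale k b
  scale-cong k ≋-refl            = ≋-refl
  scale-cong k (≋-sym p)         = ≋-sym (scale-cong k p)
  scale-cong k (≋-trans p q)     = ≋-trans (scale-cong k p) (scale-cong k q)
  scale-cong k (≋-cons p)        = ≋-cons (scale-cong k p)
  scale-cong k ≋-swap            = ≋-swap
  scale-cong k (≋-term x≈y m~m') = ≋-term (*-congˡ x≈y) m~m'
  scale-cong k ≋-merge           = ≋-trans ≋-merge (≋-coeff (sym (distribˡ k _ _)))
  scale-cong k ≋-zero            = ≋-trans (≋-coeff (zeroʳ k)) ≋-zero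

  -- spread y H m = Σ y r ⋅ H i over the factors (i , r) of m. dTerm (y , m) has this form, and it
  -- depends on the list m only through its exponent vector because the factors of each index
  -- can be collected into a single term (spread-pull).
  spread : Carrier → (ℤ → Mono) → Mono → Poly
  spread y H = map (λ p → (y * proj₂ p , H (proj₁ p)))

  spread-pull : ∀ y H i m → spread y H m ≋ ((y * expo m i , H i) ∷ spread y H (dropIndex i m))
  spread-pull y H i [] = ≋-sym (≋-trans (≋-coeff (zeroʳ y)) ≋-zero)
  spread-pull y H i ((j , r) ∷ m) with j ℤ.≟ i
  ... | yes ≡.refl = ≋-trans (≋-cons (spread-pull y H j m))
                       (≋-trans ≋-merge (≋-coeff (sym (distribˡ y r _))))
  ... | no  _      = ≋-trans (≋-cons (spread-pull y H i m)) ≋-swap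

  spread-cong-via : ∀ y H i {m m'} → m ~ m' →
    spread y H (dropIndex i m) ≋ spread y H (dropIndex i m') → spread y H m ≋ spread y H m'
  spread-cong-via y H i {m} {m'} m~m' rest =
    ≋-trans (spread-pull y H i m)
      (≋-trans (≋-coeff (*-congˡ (m~m' i)))
        (≋-trans (≋-cons rest) (≋-sym (spread-pull y H i m'))))

  spread-cong : ∀ y H {m m'} → m ~ m' → spread y H m ≋ spread y H m'
  spread-cong y H = bounded _ ℕₚ.≤-refl
    where
    bounded : ∀ n {m m'} → length m ℕ.+ length m' ≤ n → m ~ m' → spread y H m ≋ spread y H m'
    bounded _       {[]}          {[]}           _         _    = ≋-refl
    bounded zero    {_ ∷ _}                      ()
    bounded zero    {[]}          {_ ∷ _}        ()
    bounded (suc n) {(i , r) ∷ m} {m'}           (s≤s len) m~m' =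
      spread-cong-via y H i {(i , r) ∷ m} {m'} m~m'
        (bounded n shorter (dropIndex-cong i {(i , r) ∷ m} {m'} m~m'))
      where
      shorter = ℕₚ.≤-trans (ℕₚ.+-mono-≤ (length-dropIndex-head i r m) (Listₚ.length-filter _ m')) len
    bounded (suc n) {[]}          {(i , r) ∷ m'} (s≤s len) m~m' =
      spread-cong-via y H i {[]} {(i , r) ∷ m'} m~m'
        (bounded n (ℕₚ.≤-trans (length-dropIndex-head i r m') len)
                   (dropIndex-cong i {[]} {(i , r) ∷ m'} m~m'))

  spread-coeff-cong : ∀ {x y H H'} l → x ≈ y → (∀ i → H i ~ H' i) → spread x H l ≋ spread y H' l
  spread-coeff-cong []      x≈y H~H' = ≋-refl
  spread-coeff-cong (p ∷ l) x≈y H~H' =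
    ≋-trans (≋-term (*-congʳ x≈y) (H~H' (proj₁ p))) (≋-cons (spread-coeff-cong l x≈y H~H'))

  spread-merge : ∀ x y H l d → (spread x H l ++ (spread y H l ++ d)) ≋ (spread (x + y) H l ++ d)
  spread-merge x y H []      d = ≋-refl
  spread-merge x y H (p ∷ l) d =
    ≋-trans (≋-cons (↭⇒≋ (shift _ (spread x H l) (spread y H l ++ d))))
      (≋-trans ≋-merge
        (≋-trans (≋-coeff (sym (distribʳ (proj₂ p) x y))) (≋-cons (spread-merge x y H l d))))

  spread-zero : ∀ H l d → (spread 0# H l ++ d) ≋ d
  spread-zero H []      d = ≋-refl
  spread-zero H (p ∷ l) d = ≋-trans (≋-coeff (zeroˡ (proj₂ p))) (≋-trans ≋-zero (spread-zero H l d))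

  dTerm-cong : ∀ {x y m m'} → x ≈ y → m ~ m' → dTerm (x , m) ≋ dTerm (y , m')
  dTerm-cong {x} {y} {m} {m'} x≈y m~m' =
    ≋-trans (spread-coeff-cong {H = dFactor m} {H' = dFactor m'} m x≈y (λ i → ~-++ʳ {m} {m'} _ m~m'))
            (spread-cong y (dFactor m') m~m')
    where
    dFactor : Mono → ℤ → Mono
    dFactor n i = n ++ (i , - 1#) ∷ factor i

  D-cong : ∀ {a b} → a ≋ b → D a ≋ D b
  D-cong ≋-refl                      = ≋-refl
  D-cong (≋-sym p)                   = ≋-sym (D-cong p)
  D-cong (≋-trans p q)               = ≋-trans (D-cong p) (D-cong q)
  D-cong (≋-cons {t} p)              = ≋-++⁺ˡ (dTerm t) (D-cong p)
  D-cong (≋-swap {t} {u})            = ↭⇒≋ (shifts (dTerm t) (dTerm u))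
  D-cong (≋-term {a = a} x≈y m~m')   = ≋-++⁺ʳ (D a) (dTerm-cong x≈y m~m')
  D-cong (≋-merge {x} {y} {m} {a})   = spread-merge x y _ m (D a)
  D-cong (≋-zero {m} {a})            = spread-zero _ m (D a)

  fromℕ≡×1 : ∀ n → fromℕ n ≡ n · 1#
  fromℕ≡×1 zero    = ≡.refl
  fromℕ≡×1 (suc n) = ≡.cong (1# +_) (fromℕ≡×1 n)

  fromℕ-+ : ∀ a b → fromℕ (a ℕ.+ b) ≈ fromℕ a + fromℕ b
  fromℕ-+ a b rewrite fromℕ≡×1 a | fromℕ≡×1 b | fromℕ≡×1 (a ℕ.+ b) = ×-homo-+ 1# a b

  fromℕ-* : ∀ a b → fromℕ (a ℕ.* b) ≈ fromℕ a * fromℕ b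
  fromℕ-* a b rewrite fromℕ≡×1 a | fromℕ≡×1 b | fromℕ≡×1 (a ℕ.* b) = ×1-homo-* a b

  -1+1≈0 : - 1# + (1# + 0#) ≈ 0#
  -1+1≈0 = trans (+-congˡ (+-identityʳ 1#)) (-‿inverseˡ 1#)

  module _ (r : Carrier) where

    mono : ℕ → Mono
    mono j = (-[1+ 1 ] , r) ∷ (-[1+ 0 ] , fromℕ j) ∷ []

    ℓ₋₂-mono : ((-[1+ 1 ] , r) ∷ []) ~ mono 0
    ℓ₋₂-mono i with i ℤ.≟ -[1+ 1 ] | i ℤ.≟ -[1+ 0 ]
    ... | yes ≡.refl | _          = refl
    ... | no  _      | yes ≡.refl = sym (+-identityʳ 0#)
    ... | no  i≢₂    | no  i≢₁    = trans (expo-∉ (i≢₂ ∷ [])) (sym (expo-∉ (i≢₂ ∷ i≢₁ ∷ [])))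

    d-ℓ₋₂ : ∀ j → (mono j ++ (-[1+ 1 ] , - 1#) ∷ factor -[1+ 1 ]) ~ mono (suc j)
    d-ℓ₋₂ j i with i ℤ.≟ -[1+ 1 ] | i ℤ.≟ -[1+ 0 ]
    ... | yes ≡.refl | _          = +-congˡ -1+1≈0
    ... | no  _      | yes ≡.refl =
      trans (+-congˡ (+-identityʳ 1#)) (trans (+-comm _ _) (sym (+-identityʳ _)))
    ... | no  i≢₂    | no  i≢₁    =
      trans (expo-∉ (i≢₂ ∷ i≢₁ ∷ i≢₂ ∷ i≢₁ ∷ i≢₂ ∷ [])) (sym (expo-∉ (i≢₂ ∷ i≢₁ ∷ [])))

    d-ℓ₋₁ : ∀ j → (mono j ++ (-[1+ 0 ] , - 1#) ∷ factor -[1+ 0 ]) ~ mono j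
    d-ℓ₋₁ j i with i ℤ.≟ -[1+ 1 ] | i ℤ.≟ -[1+ 0 ]
    ... | yes ≡.refl | _          = refl
    ... | no  _      | yes ≡.refl = +-congˡ -1+1≈0
    ... | no  i≢₂    | no  i≢₁    =
      trans (expo-∉ (i≢₂ ∷ i≢₁ ∷ i≢₁ ∷ i≢₁ ∷ [])) (sym (expo-∉ (i≢₂ ∷ i≢₁ ∷ [])))

    dTerm-mono : ∀ x j → dTerm (x , mono j) ≋ ((x * r , mono (suc j)) ∷ (x * fromℕ j , mono j) ∷ [])
    dTerm-mono x j = ≋-trans (≋-term refl (d-ℓ₋₂ j)) (≋-cons (≋-term refl (d-ℓ₋₁ j)))

    terms : (ℕ → Carrier) → ℕ → ℕ → Poly
    terms c = applyFrom (λ j → (c j , mono j))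

    terms-upTo : ∀ c n → terms c 0 n ≡ map (λ j → (c j , mono j)) (upTo n)
    terms-upTo c n = ≡.trans (applyFrom-zero _ n) (≡.sym (Listₚ.map-upTo _ n))

    -- The identities c'_j ≈ c_(j-1) r + j c_j for j = k, …, k + n, where x stands for the part
    -- c_(k-1) r of c'_k carried over from the term before position k.
    Carries : (ℕ → Carrier) → (ℕ → Carrier) → Carrier → ℕ → ℕ → Set ℓ
    Carries c c' x k zero    = x ≈ c' k
    Carries c c' x k (suc n) = (x + c k * fromℕ k ≈ c' k) × Carries c c' (c k * r) (suc k) n

    D-terms : ∀ c c' x k n → Carries c c' x k n →
      ((x , mono k) ∷ D (terms c k n)) ≋ terms c' k (suc n)
    D-terms c c' x k zero    x≈c'k         = ≋-coeff x≈c'k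
    D-terms c c' x k (suc n) (c'k≈ , rest) = begin
      (x , mono k) ∷ dTerm (c k , mono k) ++ D (terms c (suc k) n)
        ≈⟨ ≋-cons (≋-++⁺ʳ _ (dTerm-mono (c k) k)) ⟩
      (x , mono k) ∷ (c k * r , mono (suc k)) ∷ (c k * fromℕ k , mono k) ∷ D (terms c (suc k) n)
        ≈⟨ ≋-cons ≋-swap ⟩
      (x , mono k) ∷ (c k * fromℕ k , mono k) ∷ (c k * r , mono (suc k)) ∷ D (terms c (suc k) n)
        ≈⟨ ≋-merge ⟩
      (x + c k * fromℕ k , mono k) ∷ (c k * r , mono (suc k)) ∷ D (terms c (suc k) n)
        ≈⟨ ≋-coeff c'k≈ ⟩
      (c' k , mono k) ∷ (c k * r , mono (suc k)) ∷ D (terms c (suc k) n)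
        ≈⟨ ≋-cons (D-terms c c' (c k * r) (suc k) n rest) ⟩
      terms c' k (suc (suc n)) ∎
      where open SetoidReasoning ≋-setoid

    coeff : ℕ → ℕ → Carrier
    coeff m j = pow r j * fromℕ (S j (m ∸ j))

    rotate : ∀ p a → (p * a) * r ≈ (r * p) * a
    rotate p a = trans (*-comm _ r) (sym (*-assoc r p a))

    coeff-bottom : ∀ m → 0# + coeff m 0 * fromℕ 0 ≈ coeff (suc m) 0
    coeff-bottom m = trans (+-identityˡ _) (trans (zeroʳ _)
      (sym (trans (*-congˡ (reflexive (≡.cong fromℕ (S-zero m)))) (zeroʳ 1#))))

    coeff-top : ∀ k → coeff k k * r ≈ coeff (suc k) (suc k)
    coeff-top k = unfolded
      where
      unfolded : (pow r k * fromℕ (S k (k ∸ k))) * r ≈ (r * pow r k) * fromℕ (S (suc k) (k ∸ k))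
      unfolded rewrite ℕₚ.n∸n≡0 k = rotate (pow r k) (fromℕ 1)

    coeff-step : ∀ {m k d} → m ∸ k ≡ suc d → m ∸ suc k ≡ d →
      coeff m k * r + coeff m (suc k) * fromℕ (suc k) ≈ coeff (suc m) (suc k)
    coeff-step {m} {k} {d} m∸k≡ m∸sk≡ = unfolded
      where
      p = pow r k
      unfolded : (p * fromℕ (S k (m ∸ k))) * r + ((r * p) * fromℕ (S (suc k) (m ∸ suc k))) * fromℕ (suc k)
                 ≈ (r * p) * fromℕ (S (suc k) (m ∸ k))
      unfolded rewrite m∸k≡ | m∸sk≡ = begin
        (p * fromℕ (S k (suc d))) * r + ((r * p) * fromℕ (S (suc k) d)) * fromℕ (suc k)
          ≈⟨ +-cong (rotate p _) (*-assoc _ _ _) ⟩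
        (r * p) * fromℕ (S k (suc d)) + (r * p) * (fromℕ (S (suc k) d) * fromℕ (suc k))
          ≈⟨ distribˡ (r * p) _ _ ⟨
        (r * p) * (fromℕ (S k (suc d)) + fromℕ (S (suc k) d) * fromℕ (suc k))
          ≈⟨ *-congˡ (+-congˡ (trans (*-comm _ _) (sym (fromℕ-* (suc k) (S (suc k) d))))) ⟩
        (r * p) * (fromℕ (S k (suc d)) + fromℕ (suc k ℕ.* S (suc k) d))
          ≈⟨ *-congˡ (fromℕ-+ (S k (suc d)) (suc k ℕ.* S (suc k) d)) ⟨
        (r * p) * fromℕ (S k (suc d) ℕ.+ suc k ℕ.* S (suc k) d)
          ≡⟨ ≡.cong (λ n → (r * p) * fromℕ n) (S-last k d) ⟨
        (r * p) * fromℕ (S (suc k) (suc d)) ∎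
        where open SetoidReasoning setoid

    coeff-carries : ∀ n k {m} → n ℕ.+ k ≡ m → Carries (coeff m) (coeff (suc m)) (coeff m k * r) (suc k) n
    coeff-carries zero    k ≡.refl = coeff-top k
    coeff-carries (suc d) k ≡.refl =
      coeff-step {suc d ℕ.+ k} {k} (ℕₚ.m+n∸n≡m (suc d) k) (ℕₚ.m+n∸n≡m d k) ,
      coeff-carries d (suc k) (ℕₚ.+-suc d k)

    D-coeffs : ∀ m → Carries (coeff m) (coeff (suc m)) 0# 0 (suc m)
    D-coeffs m = coeff-bottom m , coeff-carries m 0 (ℕₚ.+-identityʳ m)

    Dⁿ-ℓ₋₂ : ∀ m → Dⁿ m (ℓ^ -[1+ 1 ] r) ≋ terms (coeff m) 0 (suc m)
    Dⁿ-ℓ₋₂ zero    = ≋-term (sym (trans (*-identityˡ _) (+-identityʳ 1#))) ℓ₋₂-mono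
    Dⁿ-ℓ₋₂ (suc m) =
      ≋-trans (D-cong (Dⁿ-ℓ₋₂ m))
        (≋-trans (≋-sym ≋-zero) (D-terms (coeff m) (coeff (suc m)) 0# 0 (suc m) (D-coeffs m)))

    terms-as-product : ∀ k c n →
      scale k (terms c 0 n)
        ≋ (ℓ^ -[1+ 1 ] r ⊗ scale k (ΣP (map (λ j → (c j , (-[1+ 0 ] , fromℕ j) ∷ []) ∷ []) (upTo n))))
    terms-as-product k c n rewrite terms-upTo c n = listwise (upTo n)
      where
      listwise : ∀ l → scale k (map (λ j → (c j , mono j)) l)
        ≋ (ℓ^ -[1+ 1 ] r ⊗ scale k (ΣP (map (λ j → (c j , (-[1+ 0 ] , fromℕ j) ∷ []) ∷ []) l)))
      listwise []      = ≋-refl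
      listwise (j ∷ l) = ≋-trans (≋-coeff (sym (*-identityˡ _))) (≋-cons (listwise l))

mainTheorem9 : ∀ {c ℓ : Level} (R : CommutativeRing c ℓ) →
    let open LAlg R in
    (inv : ℕ → Carrier) → (∀ n → fromℕ (suc n) * inv n ≈ 1#) →
    (r : Carrier) →
    expYD inv (ℓ^ -[1+ 1 ] r)
      ≋ₛ (λ m → ℓ^ -[1+ 1 ] r ⊗ scale (invFact inv m)
                  (ΣP (map (λ j → (pow r j * fromℕ (S j (m ∸ j)) , (-[1+ 0 ] , fromℕ j) ∷ []) ∷ [])
                           (upTo (suc m)))))
-- Both sides scale the m-th coefficient by the same invFact inv m, so the identity holds for any inv.
mainTheorem9 R inv _ r m =
  ≋-trans (scale-cong R k (Dⁿ-ℓ₋₂ R r m)) (terms-as-product R r k (coeff R r m) (suc m))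
  where
  open LAlg R
  k = invFact inv m
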